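{- The system $C^+(I,J)z=C^-(I,J)z$ has a non-zero solution in $\mathbb{R}_{\max}^n$ if and only if \[\epsilon_{i_1 j_1} \epsilon_{i_1 j_2} = \epsilon_{i_2 j_2} \epsilon_{i_2 j_3} = \cdots =\epsilon_{i_k j_k} \epsilon_{i_k j_{k+1}} =\ominus \mathbf{1} \enspace.\] Then, this solution $z$ is determined, up to a scalar multiple, by the relations $z_r = \ominus\, t_{i_r}^{j_{r+1}-j_r}\, \epsilon_{i_r j_r}\epsilon_{i_r j_{r+1}}\, z_{r+1}$ for $r=1,\dots,k$.
   Context: $\mathbb{R}_{\max}=\mathbb{R}\cup\{ -\infty\}$ with $\oplus=\max$ and multiplication $+$; $\mathbf{0}=-\infty$ and $\mathbf{1}=0$ denote its zero and unit, and $t^{m}$ means $m\cdot t$ (tropical power). $\mathbb{S}_{\max}$ is the symmetrized max-plus semiring (elements $a$, $\ominus a$, $a^\bullet$ for $a\in\mathbb{R}_{\max}$), with $\ominus$ its sign involution, so products like $\epsilon\epsilon'$ of signs in $\{\oplus\mathbf{1},\ominus\mathbf{1}\}$ follow the usual sign rule. Fix scalars $-\infty<t_1<\dots<t_p$ and signs $\epsilon_{ij}\in\{\oplus\mathbf{1},\ominus\mathbf{1}\}$; let $C$ be the $p\times d$ matrix over $\mathbb{S}_{\max}$ with $C_{ij}=\epsilon_{ij}t_i^{j-1}$, and write $C=C^+\ominus C^-$ with $C^+,C^-$ over $\mathbb{R}_{\max}$ such that for each entry exactly one of $C^+_{ij},C^-_{ij}$ is non-zero. For index sequences $I=\{i_1<\dots<i_k\}$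 and $J=\{j_1<\dots<j_{k+1}\}$ with $k\le d-1$, $C^{\pm}(I,J)$ is the submatrix keeping rows in $I$ and columns in $J$. The unknown $z$ has $k+1$ entries (here $n=k+1$). -}

module Defs where

open import Data.Nat using (ℕ; zero; suc; _∸_) renaming (_<_ to _<ℕ_)
open import Data.Fin using (Fin; toℕ; inject₁) renaming (suc to fsuc; zero to fzero)
open import Data.Maybe using (Maybe; just; nothing)
open import Data.Product using (Σ; ∃; _×_; _,_)
open import Data.Sum using (_⊎_)
open import Relation.Binary.PropositionalEquality using (_≡_; _≢_)
open import Relation.Binary.Structures using (IsStrictTotalOrder)
open import Relation.Binary.Definitions using (tri<; tri≈; tri>)
open import Algebra.Structures using (IsCommutativeRing)

-- The real numbers, axiomatised as a complete ordered field
-- (this characterises ℝ up to isomorphism).  The statement quantifies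
-- over every such model.

record Reals : Set₁ where
  infixl 6 _+_
  infixl 7 _*_
  infix 4 _<_ _≤_
  field
    ℝ    : Set
    _+_  : ℝ → ℝ → ℝ
    _*_  : ℝ → ℝ → ℝ
    -_   : ℝ → ℝ
    0#   : ℝ
    1#   : ℝ
    _<_  : ℝ → ℝ → Set
    isCommutativeRing  : IsCommutativeRing _≡_ _+_ _*_ -_ 0# 1#
    0≢1                : 0# ≢ 1#
    inverse            : ∀ x → x ≢ 0# → ∃ λ y → x * y ≡ 1#
    isStrictTotalOrder : IsStrictTotalOrder _≡_ _<_
    +-mono-<           : ∀ {x y} z → x < y → x + z < y + z
    *-pos              : ∀ {x y} → 0# < x → 0# < y → 0# < x * y

  _≤_ : ℝ → ℝ → Set
  x ≤ y = x < y ⊎ x ≡ y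

  field
    complete : (S : ℝ → Set) → ∃ S → (∃ λ b → ∀ x → S x → x ≤ b) →
               ∃ λ s → (∀ x → S x → x ≤ s) ×
                       (∀ b → (∀ x → S x → x ≤ b) → s ≤ b)

module Tropical (R : Reals) where
  open Reals R public
  open IsStrictTotalOrder isStrictTotalOrder using (compare)

  -- ℝmax = ℝ ∪ {-∞}; nothing = -∞ = 𝟘, just 0# = 𝟙
  Rmax : Set
  Rmax = Maybe ℝ

  𝟘 : Rmax
  𝟘 = nothing

  infixl 6 _⊕_
  infixl 7 _⊗_

  _⊕_ : Rmax → Rmax → Rmax
  nothing ⊕ b = b
  just a ⊕ nothing = just a
  just a ⊕ just b with compare a b
  ... | tri< _ _ _ = just b
  ... | tri≈ _ _ _ = just a
  ... | tri> _ _ _ = just a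

  _⊗_ : Rmax → Rmax → Rmax
  nothing ⊗ _ = nothing
  just a ⊗ nothing = nothing
  just a ⊗ just b = just (a + b)

  ⨁ : ∀ {n} → (Fin n → Rmax) → Rmax
  ⨁ {zero}  f = nothing
  ⨁ {suc n} f = f fzero ⊕ ⨁ (λ i → f (fsuc i))

  -- natural multiple m·t, so that the tropical power t^m is m·t
  _·_ : ℕ → ℝ → ℝ
  zero  · t = 0#
  suc m · t = t + m · t

  -- Symmetrized max-plus semiring 𝕊max, in canonical form:
  -- 𝟘ₛ is the zero (-∞, with a = ⊖a = a• for a = -∞),
  -- pos a = a, neg a = ⊖a, bal a = a• for a ∈ ℝ.
  data Smax : Set where
    𝟘ₛ  : Smax
    pos : ℝ → Smax
    neg : ℝ → Smax
    bal : ℝ → Smax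

  ⊖_ : Smax → Smax
  ⊖ 𝟘ₛ    = 𝟘ₛ
  ⊖ pos a = neg a
  ⊖ neg a = pos a
  ⊖ bal a = bal a

  infixl 7 _⊙_
  _⊙_ : Smax → Smax → Smax
  𝟘ₛ    ⊙ _     = 𝟘ₛ
  _     ⊙ 𝟘ₛ    = 𝟘ₛ
  pos a ⊙ pos b = pos (a + b)
  pos a ⊙ neg b = neg (a + b)
  neg a ⊙ pos b = neg (a + b)
  neg a ⊙ neg b = pos (a + b)
  bal a ⊙ pos b = bal (a + b)
  bal a ⊙ neg b = bal (a + b)
  bal a ⊙ bal b = bal (a + b)
  pos a ⊙ bal b = bal (a + b)
  neg a ⊙ bal b = bal (a + b)

  ι : Rmax → Smax
  ι nothing  = 𝟘ₛ
  ι (just a) = pos a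

  data Sign : Set where
    ⊕𝟙 ⊖𝟙 : Sign

  ⟦_⟧ : Sign → Smax
  ⟦ ⊕𝟙 ⟧ = pos 0#
  ⟦ ⊖𝟙 ⟧ = neg 0#

  -- C = C⁺ ⊖ C⁻ with C_ij = ε_ij t_i^(j-1)  (columns 0-indexed: toℕ j = j-1)
  C⁺ : ∀ {p d} → (Fin p → ℝ) → (Fin p → Fin d → Sign) → Fin p → Fin d → Rmax
  C⁺ t ε i j with ε i j
  ... | ⊕𝟙 = just (toℕ j · t i)
  ... | ⊖𝟙 = nothing

  C⁻ : ∀ {p d} → (Fin p → ℝ) → (Fin p → Fin d → Sign) → Fin p → Fin d → Rmax
  C⁻ t ε i j with ε i j
  ... | ⊕𝟙 = nothing
  ... | ⊖𝟙 = just (toℕ j · t i)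

  _⊠_ : ∀ {m n} → (Fin m → Fin n → Rmax) → (Fin n → Rmax) → Fin m → Rmax
  (A ⊠ z) r = ⨁ (λ s → A r s ⊗ z s)

  sub : ∀ {p d k n} → (Fin p → Fin d → Rmax) → (Fin k → Fin p) → (Fin n → Fin d) →
        Fin k → Fin n → Rmax
  sub M I J r s = M (I r) (J s)

  StrictlyIncreasingFin : ∀ {m n} → (Fin m → Fin n) → Set
  StrictlyIncreasingFin {m} f = ∀ (a b : Fin m) → toℕ a <ℕ toℕ b → toℕ (f a) <ℕ toℕ (f b)

  StrictlyIncreasingℝ : ∀ {m} → (Fin m → ℝ) → Set
  StrictlyIncreasingℝ {m} f = ∀ (a b : Fin m) → toℕ a <ℕ toℕ b → f a < f b

  NonZero : ∀ {n} → (Fin n → Rmax) → Set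
  NonZero z = ∃ λ s → z s ≢ nothing

module Submission where

-- Row r of C⁺(I,J) z = C⁻(I,J) z says that the largest of the terms |C_{i_r j_s}| + z_s is attained at a
-- positive and at a negative entry. The modulus matrix (r, s) ↦ |C_{i_r j_s}| = (j_s − 1) t_{i_r} is
-- strictly supermodular, so the maximising columns move weakly rightwards as r grows; k rows, each
-- needing two maximisers among k + 1 columns, force row r to be maximised exactly at columns r and
-- r + 1. These entries therefore have opposite signs and equal terms, which is the stated recurrence.
-- Conversely, equal consecutive terms make every row unimodal with its plateau at columns r and r + 1,
-- and opposite signs there balance the row.

open import Defs
open import Data.Nat as ℕ using (ℕ; suc; _∸_) renaming (_≤_ to _≤ℕ_)
open import Data.Fin as Fin using (Fin; toℕ; inject₁) renaming (suc to fsuc)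
open import Data.Maybe using (just; nothing)
open import Data.Product using (∃; _×_; _,_; proj₁; proj₂)
open import Function.Bundles using (_⇔_; mk⇔; Equivalence)
open import Relation.Binary.PropositionalEquality
  using (_≡_; _≢_; refl; sym; trans; cong; cong₂; subst; subst₂)

import Data.Nat.Properties as ℕₚ
import Data.Fin.Properties as Finₚ
open import Data.Fin.Induction using (<-weakInduction; >-weakInduction)
open import Data.Sum using (_⊎_; inj₁; inj₂; [_,_]′)
open import Data.Maybe.Properties using (just-injective)
open import Data.Empty using (⊥-elim)
open import Function.Base using (_∘_; id)
open import Function.Properties.Equivalence using () renaming (trans to ⇔-trans; sym to ⇔-sym)
open import Relation.Nullary using (¬_; contradiction)
open import Relation.Binary.Bundles using (StrictTotalOrder; Preorder)
open import Relation.Binary.Structures using (IsStrictTotalOrder)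
open import Relation.Binary.Definitions using (tri<; tri≈; tri>)
open import Algebra.Bundles using (CommutativeRing)
import Algebra.Properties.AbelianGroup as AbelianGroupProperties
import Algebra.Properties.CommutativeSemigroup as CommutativeSemigroupProperties
import Relation.Binary.Properties.StrictTotalOrder as StrictTotalOrderProperties
import Relation.Binary.Reasoning.StrictPartialOrder as StrictReasoning

module OrderedReals (R : Reals) where
  open Reals R
  open Tropical R using (_·_)

  ring : CommutativeRing _ _
  ring = record { isCommutativeRing = isCommutativeRing }

  open CommutativeRing ring public using (+-assoc; +-identityʳ)
  open CommutativeRing ring using (+-comm; +-identityˡ; +-abelianGroup; +-commutativeSemigroup)
  open AbelianGroupProperties +-abelianGroup public using (∙-cancelˡ)
  open AbelianGroupProperties +-abelianGroup using (//-rightDividesʳ)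
  open CommutativeSemigroupProperties +-commutativeSemigroup using (interchange; xy∙z≈xz∙y)

  ℝ-strictTotalOrder : StrictTotalOrder _ _ _
  ℝ-strictTotalOrder = record { isStrictTotalOrder = isStrictTotalOrder }

  open StrictTotalOrder ℝ-strictTotalOrder using (strictPartialOrder)
  open StrictTotalOrderProperties ℝ-strictTotalOrder public
    using () renaming (preorder to ≤-preorder; antisym to ≤-antisym; trans to ≤-trans)
  module ≤-Reasoning = StrictReasoning strictPartialOrder
  open ≤-Reasoning

  +-monoʳ-< : ∀ z {x y} → x < y → z + x < z + y
  +-monoʳ-< z {x} {y} x<y = subst₂ _<_ (+-comm x z) (+-comm y z) (+-mono-< z x<y)

  +-monoʳ-≤ : ∀ z {x y} → x ≤ y → z + x ≤ z + y
  +-monoʳ-≤ z (inj₁ x<y) = inj₁ (+-monoʳ-< z x<y)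
  +-monoʳ-≤ z (inj₂ refl) = inj₂ refl

  +-mono-<-≤ : ∀ {a b c d} → a < b → c ≤ d → a + c < b + d
  +-mono-<-≤ {a} {b} {c} {d} a<b c≤d = begin-strict
    a + c  <⟨ +-mono-< c a<b ⟩
    b + c  ≤⟨ +-monoʳ-≤ b c≤d ⟩
    b + d  ∎

  +-mono-≤ : ∀ {a b c d} → a ≤ b → c ≤ d → a + c ≤ b + d
  +-mono-≤ (inj₁ a<b) c≤d = inj₁ (+-mono-<-≤ a<b c≤d)
  +-mono-≤ (inj₂ refl) c≤d = +-monoʳ-≤ _ c≤d

  +-cancelʳ-< : ∀ z {x y} → x + z < y + z → x < y
  +-cancelʳ-< z {x} {y} lt = subst₂ _<_ (//-rightDividesʳ z x) (//-rightDividesʳ z y) (+-mono-< (- z) lt)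

  +-cancelˡ-< : ∀ z {x y} → z + x < z + y → x < y
  +-cancelˡ-< z {x} {y} lt = +-cancelʳ-< z (subst₂ _<_ (+-comm z x) (+-comm z y) lt)

  ·-distribʳ-+ : ∀ m n x → (m ℕ.+ n) · x ≡ m · x + n · x
  ·-distribʳ-+ ℕ.zero n x = sym (+-identityˡ (n · x))
  ·-distribʳ-+ (suc m) n x = trans (cong (x +_) (·-distribʳ-+ m n x)) (sym (+-assoc x (m · x) (n · x)))

  ·-monoʳ-≤ : ∀ m {x y} → x ≤ y → m · x ≤ m · y
  ·-monoʳ-≤ ℕ.zero x≤y = inj₂ refl
  ·-monoʳ-≤ (suc m) x≤y = +-mono-≤ x≤y (·-monoʳ-≤ m x≤y)

  ·-supermodular : ∀ {m n x y} → m ℕ.< n → x < y → n · x + m · y < m · x + n · y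
  ·-supermodular {m} {n} {x} {y} m<n x<y with ℕₚ.m≤n⇒∃[o]m+o≡n m<n
  ... | c , refl = begin-strict
    (suc m ℕ.+ c) · x + m · y   ≡⟨ cong (_+ m · y) (split x) ⟩
    m · x + suc c · x + m · y   ≡⟨ xy∙z≈xz∙y (m · x) (suc c · x) (m · y) ⟩
    m · x + m · y + suc c · x   <⟨ +-monoʳ-< (m · x + m · y) (+-mono-<-≤ x<y (·-monoʳ-≤ c (inj₁ x<y))) ⟩
    m · x + m · y + suc c · y   ≡⟨ +-assoc (m · x) (m · y) (suc c · y) ⟩
    m · x + (m · y + suc c · y) ≡⟨ cong (m · x +_) (split y) ⟨
    m · x + (suc m ℕ.+ c) · y   ∎
    where
    split : ∀ z → (suc m ℕ.+ c) · z ≡ m · z + suc c · z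
    split z = trans (cong (_· z) (sym (ℕₚ.+-suc m c))) (·-distribʳ-+ m (suc c) z)

  StrictlySupermodular : ∀ {m n} → (Fin m → Fin n → ℝ) → Set
  StrictlySupermodular a =
    ∀ {r₁ r₂ s₁ s₂} → r₁ Fin.< r₂ → s₁ Fin.< s₂ → a r₁ s₂ + a r₂ s₁ < a r₁ s₁ + a r₂ s₂

  supermodular-columnShift : ∀ {m n} {a : Fin m → Fin n → ℝ} → StrictlySupermodular a →
    ∀ {r₁ r₂ s₁ s₂} → r₁ Fin.< r₂ → s₁ Fin.< s₂ → ∀ x₁ x₂ →
    (a r₁ s₂ + x₂) + (a r₂ s₁ + x₁) < (a r₁ s₁ + x₁) + (a r₂ s₂ + x₂)
  supermodular-columnShift {a = a} a-sm {r₁} {r₂} {s₁} {s₂} r₁<r₂ s₁<s₂ x₁ x₂ = begin-strict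
    (a r₁ s₂ + x₂) + (a r₂ s₁ + x₁)  ≡⟨ interchange _ _ _ _ ⟩
    (a r₁ s₂ + a r₂ s₁) + (x₂ + x₁)  <⟨ +-mono-< (x₂ + x₁) (a-sm r₁<r₂ s₁<s₂) ⟩
    (a r₁ s₁ + a r₂ s₂) + (x₂ + x₁)  ≡⟨ cong (a r₁ s₁ + a r₂ s₂ +_) (+-comm x₂ x₁) ⟩
    (a r₁ s₁ + a r₂ s₂) + (x₁ + x₂)  ≡⟨ interchange _ _ _ _ ⟨
    (a r₁ s₁ + x₁) + (a r₂ s₂ + x₂)  ∎


module MaxPlus (R : Reals) where
  open Tropical R
  open OrderedReals R
  open IsStrictTotalOrder isStrictTotalOrder using (compare)
  open import Relation.Binary.Construct.Add.Infimum.NonStrict _≤_ public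
    using (_≤₋_; ⊥₋≤_; [_]; [≤]-injective)
  open import Relation.Binary.Construct.Add.Infimum.NonStrict _≤_
    using (≤₋-trans; ≤₋-antisym-≡)

  ≤₋-refl : ∀ {x} → x ≤₋ x
  ≤₋-refl {nothing} = ⊥₋≤ nothing
  ≤₋-refl {just a} = [ inj₂ refl ]

  x≤x⊕y : ∀ x y → x ≤₋ x ⊕ y
  x≤x⊕y nothing y = ⊥₋≤ y
  x≤x⊕y (just a) nothing = ≤₋-refl
  x≤x⊕y (just a) (just b) with compare a b
  ... | tri< a<b _ _ = [ inj₁ a<b ]
  ... | tri≈ _ _ _ = ≤₋-refl
  ... | tri> _ _ _ = ≤₋-refl

  y≤x⊕y : ∀ x y → y ≤₋ x ⊕ y
  y≤x⊕y nothing y = ≤₋-refl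
  y≤x⊕y (just a) nothing = ⊥₋≤ just a
  y≤x⊕y (just a) (just b) with compare a b
  ... | tri< _ _ _ = ≤₋-refl
  ... | tri≈ _ a≡b _ = [ inj₂ (sym a≡b) ]
  ... | tri> _ _ b<a = [ inj₁ b<a ]

  ⊕-lub : ∀ {x y z} → x ≤₋ z → y ≤₋ z → x ⊕ y ≤₋ z
  ⊕-lub (⊥₋≤ _) y≤z = y≤z
  ⊕-lub [ a≤c ] (⊥₋≤ _) = [ a≤c ]
  ⊕-lub {just a} {just b} [ a≤c ] [ b≤c ] with compare a b
  ... | tri< _ _ _ = [ b≤c ]
  ... | tri≈ _ _ _ = [ a≤c ]
  ... | tri> _ _ _ = [ a≤c ]

  ⊕-sel : ∀ x y → x ⊕ y ≡ x ⊎ x ⊕ y ≡ y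
  ⊕-sel nothing y = inj₂ refl
  ⊕-sel (just a) nothing = inj₁ refl
  ⊕-sel (just a) (just b) with compare a b
  ... | tri< _ _ _ = inj₂ refl
  ... | tri≈ _ _ _ = inj₁ refl
  ... | tri> _ _ _ = inj₁ refl

  UpperBound : ∀ {n} → (Fin n → Rmax) → ℝ → Set
  UpperBound f M = ∀ s → f s ≤₋ just M

  ⨁-cong : ∀ {n} {f g : Fin n → Rmax} → (∀ s → f s ≡ g s) → ⨁ f ≡ ⨁ g
  ⨁-cong {ℕ.zero} f≗g = refl
  ⨁-cong {suc n} f≗g = cong₂ _⊕_ (f≗g Fin.zero) (⨁-cong (f≗g ∘ fsuc))

  ≤-⨁ : ∀ {n} (f : Fin n → Rmax) s → f s ≤₋ ⨁ f
  ≤-⨁ f Fin.zero = x≤x⊕y _ _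
  ≤-⨁ f (fsuc s) = ≤₋-trans ≤-trans (≤-⨁ (f ∘ fsuc) s) (y≤x⊕y (f Fin.zero) _)

  ⨁-lub : ∀ {n} {f : Fin n → Rmax} {x} → (∀ s → f s ≤₋ x) → ⨁ f ≤₋ x
  ⨁-lub {ℕ.zero} _ = ⊥₋≤ _
  ⨁-lub {suc n} f≤x = ⊕-lub (f≤x Fin.zero) (⨁-lub (f≤x ∘ fsuc))

  ⨁-sel : ∀ {n} (f : Fin n → Rmax) → ⨁ f ≡ nothing ⊎ ∃ λ s → ⨁ f ≡ f s
  ⨁-sel {ℕ.zero} f = inj₁ refl
  ⨁-sel {suc n} f with ⊕-sel (f Fin.zero) (⨁ (f ∘ fsuc)) | ⨁-sel (f ∘ fsuc)
  ... | inj₁ e | _ = inj₂ (Fin.zero , e)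
  ... | inj₂ e | inj₁ e′ = inj₁ (trans e e′)
  ... | inj₂ e | inj₂ (s , e′) = inj₂ (fsuc s , trans e e′)

  ⨁-≡-just : ∀ {n} {f : Fin n → Rmax} {M} → ⨁ f ≡ just M ⇔ (UpperBound f M × ∃ λ s → f s ≡ just M)
  ⨁-≡-just {f = f} {M} = mk⇔ to from
    where
    to : ⨁ f ≡ just M → UpperBound f M × ∃ λ s → f s ≡ just M
    to ⨁f≡M with ⨁-sel f
    ... | inj₁ ⨁f≡0 with () ← trans (sym ⨁f≡0) ⨁f≡M
    to ⨁f≡M | inj₂ (s , ⨁f≡fs) = (λ s′ → subst (f s′ ≤₋_) ⨁f≡M (≤-⨁ f s′)) , s , trans (sym ⨁f≡fs) ⨁f≡M
    from : UpperBound f M × (∃ λ s → f s ≡ just M) → ⨁ f ≡ just M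
    from (f≤M , s , fs≡M) = ≤₋-antisym-≡ ≤-antisym (⨁-lub f≤M) (subst (_≤₋ ⨁ f) fs≡M (≤-⨁ f s))

  ⨁-≡-nothing : ∀ {n} {f : Fin n → Rmax} → ⨁ f ≡ nothing → ∀ s → f s ≡ nothing
  ⨁-≡-nothing {f = f} ⨁f≡0 s with f s | subst (f s ≤₋_) ⨁f≡0 (≤-⨁ f s)
  ... | nothing | _ = refl

  just-⊗-≡-just : ∀ {a x M} → just a ⊗ x ≡ just M → ∃ λ v → x ≡ just v × a + v ≡ M
  just-⊗-≡-just {x = just v} refl = v , refl , refl

  just-⊗-≡-nothing : ∀ {a x} → just a ⊗ x ≡ nothing → x ≡ nothing
  just-⊗-≡-nothing {x = nothing} _ = refl

  just-⊗-cancel : ∀ {a x y} → just a ⊗ x ≡ just a ⊗ y → x ≡ y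
  just-⊗-cancel {x = nothing} {nothing} _ = refl
  just-⊗-cancel {a} {just u} {just v} a+u≡a+v = cong just (∙-cancelˡ a u v (just-injective a+u≡a+v))

  just-⊗-assoc : ∀ a b x → just (a + b) ⊗ x ≡ just a ⊗ (just b ⊗ x)
  just-⊗-assoc a b nothing = refl
  just-⊗-assoc a b (just v) = cong just (+-assoc a b v)

  ≢nothing⇒just : ∀ {x : Rmax} → x ≢ nothing → ∃ λ v → x ≡ just v
  ≢nothing⇒just {just v} _ = v , refl
  ≢nothing⇒just {nothing} x≢0 = ⊥-elim (x≢0 refl)

  just-⊗-just : ∀ {a b x y} → just a ⊗ x ≡ just b ⊗ y → (∃ λ u → x ≡ just u) → ∃ λ v → y ≡ just v
  just-⊗-just {y = just v} _ _ = v , refl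
  just-⊗-just {y = nothing} ax≡by (u , refl) with () ← ax≡by

  onSign : Sign → Sign → Rmax → Rmax
  onSign ⊕𝟙 ⊕𝟙 x = x
  onSign ⊖𝟙 ⊖𝟙 x = x
  onSign ⊕𝟙 ⊖𝟙 _ = nothing
  onSign ⊖𝟙 ⊕𝟙 _ = nothing

  onSign-same : ∀ {e e′} x → e′ ≡ e → onSign e e′ x ≡ x
  onSign-same {⊕𝟙} x refl = refl
  onSign-same {⊖𝟙} x refl = refl

  onSign-≡-just : ∀ e e′ {x M} → onSign e e′ x ≡ just M → e′ ≡ e × x ≡ just M
  onSign-≡-just ⊕𝟙 ⊕𝟙 x≡M = refl , x≡M
  onSign-≡-just ⊖𝟙 ⊖𝟙 x≡M = refl , x≡M

  onSign-≤ : ∀ e e′ {x y} → x ≤₋ y → onSign e e′ x ≤₋ y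
  onSign-≤ ⊕𝟙 ⊕𝟙 x≤y = x≤y
  onSign-≤ ⊖𝟙 ⊖𝟙 x≤y = x≤y
  onSign-≤ ⊕𝟙 ⊖𝟙 _ = ⊥₋≤ _
  onSign-≤ ⊖𝟙 ⊕𝟙 _ = ⊥₋≤ _

  onSign-≤⁻¹ : ∀ e {x y} → onSign ⊕𝟙 e x ≤₋ y → onSign ⊖𝟙 e x ≤₋ y → x ≤₋ y
  onSign-≤⁻¹ ⊕𝟙 x≤y _ = x≤y
  onSign-≤⁻¹ ⊖𝟙 _ x≤y = x≤y

  onSign-≡-nothing⁻¹ : ∀ e {x} → onSign ⊕𝟙 e x ≡ nothing → onSign ⊖𝟙 e x ≡ nothing → x ≡ nothing
  onSign-≡-nothing⁻¹ ⊕𝟙 x≡0 _ = x≡0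
  onSign-≡-nothing⁻¹ ⊖𝟙 _ x≡0 = x≡0

  distinct-signs-cover : ∀ {e₁ e₂ : Sign} → e₁ ≢ e₂ → ∀ e → e₁ ≡ e ⊎ e₂ ≡ e
  distinct-signs-cover {⊕𝟙} {⊕𝟙} e₁≢e₂ _ = ⊥-elim (e₁≢e₂ refl)
  distinct-signs-cover {⊖𝟙} {⊖𝟙} e₁≢e₂ _ = ⊥-elim (e₁≢e₂ refl)
  distinct-signs-cover {⊕𝟙} {⊖𝟙} _ ⊕𝟙 = inj₁ refl
  distinct-signs-cover {⊕𝟙} {⊖𝟙} _ ⊖𝟙 = inj₂ refl
  distinct-signs-cover {⊖𝟙} {⊕𝟙} _ ⊕𝟙 = inj₂ refl
  distinct-signs-cover {⊖𝟙} {⊕𝟙} _ ⊖𝟙 = inj₁ refl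

  Balanced : ∀ {n} → (Fin n → Sign) → (Fin n → Rmax) → Set
  Balanced σ f = ⨁ (λ s → onSign ⊕𝟙 (σ s) (f s)) ≡ ⨁ (λ s → onSign ⊖𝟙 (σ s) (f s))

  record OppositeSignMaximum {n} (σ : Fin n → Sign) (f : Fin n → Rmax) : Set where
    field
      value        : ℝ
      lo hi        : Fin n
      lo<hi        : lo Fin.< hi
      signs-differ : σ lo ≢ σ hi
      attained-lo  : f lo ≡ just value
      attained-hi  : f hi ≡ just value
      upper-bound  : UpperBound f value

  oppositeSignMaximum⇒balanced : ∀ {n} {σ : Fin n → Sign} {f} → OppositeSignMaximum σ f → Balanced σ f
  oppositeSignMaximum⇒balanced {σ = σ} {f} m = trans (⨁-on ⊕𝟙) (sym (⨁-on ⊖𝟙))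
    where
    open OppositeSignMaximum m
    attained-on : ∀ e → σ lo ≡ e ⊎ σ hi ≡ e → ∃ λ s → onSign e (σ s) (f s) ≡ just value
    attained-on e (inj₁ σlo≡e) = lo , trans (onSign-same (f lo) σlo≡e) attained-lo
    attained-on e (inj₂ σhi≡e) = hi , trans (onSign-same (f hi) σhi≡e) attained-hi
    ⨁-on : ∀ e → ⨁ (λ s → onSign e (σ s) (f s)) ≡ just value
    ⨁-on e = Equivalence.from ⨁-≡-just
      ( (λ s → onSign-≤ e (σ s) (upper-bound s))
      , attained-on e (distinct-signs-cover signs-differ e))

  oppositeSignMaximum : ∀ {n} {σ : Fin n → Sign} {f M s s′} → UpperBound f M →
    f s ≡ just M → f s′ ≡ just M → σ s ≢ σ s′ → OppositeSignMaximum σ f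
  oppositeSignMaximum {s = s} {s′} bound fs≡M fs′≡M σs≢σs′ with Finₚ.<-cmp s s′
  ... | tri< s<s′ _ _ = record
    { value = _ ; lo = s ; hi = s′ ; lo<hi = s<s′ ; signs-differ = σs≢σs′
    ; attained-lo = fs≡M ; attained-hi = fs′≡M ; upper-bound = bound }
  ... | tri> _ _ s′<s = record
    { value = _ ; lo = s′ ; hi = s ; lo<hi = s′<s ; signs-differ = σs≢σs′ ∘ sym
    ; attained-lo = fs′≡M ; attained-hi = fs≡M ; upper-bound = bound }
  ... | tri≈ _ refl _ = ⊥-elim (σs≢σs′ refl)

  balanced⇒oppositeSignMaximum : ∀ {n} {σ : Fin n → Sign} {f} →
    (∃ λ s → f s ≢ nothing) → Balanced σ f → OppositeSignMaximum σ f
  balanced⇒oppositeSignMaximum {σ = σ} {f} (s₀ , fs₀≢0) balanced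
    with ⨁ (λ s → onSign ⊕𝟙 (σ s) (f s)) in ⨁₊≡
  ... | nothing = ⊥-elim (fs₀≢0 (onSign-≡-nothing⁻¹ (σ s₀)
        (⨁-≡-nothing ⨁₊≡ s₀) (⨁-≡-nothing (sym balanced) s₀)))
  ... | just M with Equivalence.to ⨁-≡-just ⨁₊≡ | Equivalence.to ⨁-≡-just (sym balanced)
  ...   | bound₊ , s₊ , attained₊ | bound₋ , s₋ , attained₋
    with onSign-≡-just ⊕𝟙 (σ s₊) attained₊ | onSign-≡-just ⊖𝟙 (σ s₋) attained₋
  ...     | σs₊≡⊕ , fs₊≡M | σs₋≡⊖ , fs₋≡M =
    oppositeSignMaximum (λ s → onSign-≤⁻¹ (σ s) (bound₊ s) (bound₋ s)) fs₊≡M fs₋≡M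
      (λ σs₊≡σs₋ → ⊕≢⊖ (trans (sym σs₊≡⊕) (trans σs₊≡σs₋ σs₋≡⊖)))
    where ⊕≢⊖ : ⊕𝟙 ≢ ⊖𝟙
          ⊕≢⊖ ()

  ι-injective : ∀ {x y} → ι x ≡ ι y → x ≡ y
  ι-injective {nothing} {nothing} _ = refl
  ι-injective {just a} {just b} refl = refl

  signProduct≡⊖𝟙⇔≢ : ∀ {e₁ e₂} → ⟦ e₁ ⟧ ⊙ ⟦ e₂ ⟧ ≡ ⟦ ⊖𝟙 ⟧ ⇔ e₁ ≢ e₂
  signProduct≡⊖𝟙⇔≢ {⊕𝟙} {⊕𝟙} = mk⇔ (λ ()) (λ ⊕≢⊕ → ⊥-elim (⊕≢⊕ refl))
  signProduct≡⊖𝟙⇔≢ {⊖𝟙} {⊖𝟙} = mk⇔ (λ ()) (λ ⊖≢⊖ → ⊥-elim (⊖≢⊖ refl))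
  signProduct≡⊖𝟙⇔≢ {⊕𝟙} {⊖𝟙} = mk⇔ (λ _ ()) (λ _ → cong neg (+-identityʳ 0#))
  signProduct≡⊖𝟙⇔≢ {⊖𝟙} {⊕𝟙} = mk⇔ (λ _ ()) (λ _ → cong neg (+-identityʳ 0#))

  pos⊙oppositeSigns : ∀ {e₁ e₂} → ⟦ e₁ ⟧ ⊙ ⟦ e₂ ⟧ ≡ ⟦ ⊖𝟙 ⟧ → ∀ c → pos c ⊙ ⟦ e₁ ⟧ ⊙ ⟦ e₂ ⟧ ≡ neg c
  pos⊙oppositeSigns {⊕𝟙} {⊖𝟙} _ c = cong neg (trans (+-identityʳ (c + 0#)) (+-identityʳ c))
  pos⊙oppositeSigns {⊖𝟙} {⊕𝟙} _ c = cong neg (trans (+-identityʳ (c + 0#)) (+-identityʳ c))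

  ⊖-neg⊙ι : ∀ c y → ⊖ (neg c ⊙ ι y) ≡ ι (just c ⊗ y)
  ⊖-neg⊙ι c nothing = refl
  ⊖-neg⊙ι c (just v) = refl

  signedRelation⇔ : ∀ {e₁ e₂ c x y} → ⟦ e₁ ⟧ ⊙ ⟦ e₂ ⟧ ≡ ⟦ ⊖𝟙 ⟧ →
    (ι x ≡ ⊖ (pos c ⊙ ⟦ e₁ ⟧ ⊙ ⟦ e₂ ⟧ ⊙ ι y)) ⇔ (x ≡ just c ⊗ y)
  signedRelation⇔ {e₁} {e₂} {c} {x} {y} opposite = mk⇔
    (λ ιx≡ → ι-injective (trans ιx≡ ⊖-rhs))
    (λ x≡ → trans (cong ι x≡) (sym ⊖-rhs))
    where
    ⊖-rhs : ⊖ (pos c ⊙ ⟦ e₁ ⟧ ⊙ ⟦ e₂ ⟧ ⊙ ι y) ≡ ι (just c ⊗ y)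
    ⊖-rhs = trans (cong (λ u → ⊖ (u ⊙ ι y)) (pos⊙oppositeSigns opposite c)) (⊖-neg⊙ι c y)

inject₁<fsuc : ∀ {n} (i : Fin n) → inject₁ i Fin.< fsuc i
inject₁<fsuc i = Finₚ.≤̄⇒inject₁< ℕₚ.≤-refl

neighbour-induction : ∀ {n ℓ} (P : Fin (suc n) → Set ℓ) →
  (∀ i → P (inject₁ i) → P (fsuc i)) → (∀ i → P (fsuc i) → P (inject₁ i)) →
  ∀ {s₀} → P s₀ → ∀ s → P s
neighbour-induction P forward backward {s₀} Ps₀ = <-weakInduction P (P-zero s₀ Ps₀) forward
  where
  P-zero : ∀ s → P s → P Fin.zero
  P-zero = <-weakInduction (λ s → P s → P Fin.zero) id (λ i back → back ∘ backward i)

iterateBackward : ∀ {k} {A : Set} → (Fin k → A → A) → A → Fin (suc k) → A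
iterateBackward {ℕ.zero} step w₀ _ = w₀
iterateBackward {suc k} step w₀ Fin.zero = step Fin.zero (iterateBackward (step ∘ fsuc) w₀ Fin.zero)
iterateBackward {suc k} step w₀ (fsuc s) = iterateBackward (step ∘ fsuc) w₀ s

iterateBackward-inject₁ : ∀ {k} {A : Set} (step : Fin k → A → A) w₀ r →
  iterateBackward step w₀ (inject₁ r) ≡ step r (iterateBackward step w₀ (fsuc r))
iterateBackward-inject₁ step w₀ Fin.zero = refl
iterateBackward-inject₁ step w₀ (fsuc r) = iterateBackward-inject₁ (step ∘ fsuc) w₀ r

interlacing : ∀ {k} (lo hi : Fin k → Fin (suc k)) → (∀ r → lo r Fin.< hi r) →
  (∀ {r r′} → r Fin.< r′ → hi r Fin.≤ lo r′) → ∀ r → lo r ≡ inject₁ r × hi r ≡ fsuc r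
interlacing {suc n} lo hi lo<hi hi≤lo r =
  Finₚ.toℕ-injective (trans (ℕₚ.≤-antisym lo≤r (r≤lo r)) (sym (Finₚ.toℕ-inject₁ r))) ,
  Finₚ.toℕ-injective (ℕₚ.≤-antisym (hi≤1+r r) (ℕₚ.<-≤-trans (ℕ.s≤s (r≤lo r)) (lo<hi r)))
  where
  open ℕₚ.≤-Reasoning
  consecutive : ∀ i → hi (inject₁ i) Fin.≤ lo (fsuc i)
  consecutive i = hi≤lo (inject₁<fsuc i)

  r≤lo : ∀ r → toℕ r ℕ.≤ toℕ (lo r)
  r≤lo = <-weakInduction (λ r → toℕ r ℕ.≤ toℕ (lo r)) ℕ.z≤n λ i ih → begin
    suc (toℕ i)                 ≡⟨ cong suc (Finₚ.toℕ-inject₁ i) ⟨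
    suc (toℕ (inject₁ i))       ≤⟨ ℕ.s≤s ih ⟩
    suc (toℕ (lo (inject₁ i)))  ≤⟨ lo<hi (inject₁ i) ⟩
    toℕ (hi (inject₁ i))        ≤⟨ consecutive i ⟩
    toℕ (lo (fsuc i))           ∎

  hi≤1+r : ∀ r → toℕ (hi r) ℕ.≤ suc (toℕ r)
  hi≤1+r = >-weakInduction (λ r → toℕ (hi r) ℕ.≤ suc (toℕ r))
    (begin
      toℕ (hi (Fin.fromℕ n))   ≤⟨ Finₚ.toℕ≤pred[n] (hi _) ⟩
      suc n                    ≡⟨ cong suc (Finₚ.toℕ-fromℕ n) ⟨
      suc (toℕ (Fin.fromℕ n))  ∎)
    λ i ih → begin
      toℕ (hi (inject₁ i))   ≤⟨ ℕₚ.≤-pred (begin-strict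
        toℕ (hi (inject₁ i))   ≤⟨ consecutive i ⟩
        toℕ (lo (fsuc i))      <⟨ lo<hi (fsuc i) ⟩
        toℕ (hi (fsuc i))      ≤⟨ ih ⟩
        suc (suc (toℕ i))      ∎) ⟩
      suc (toℕ i)            ≡⟨ cong suc (Finₚ.toℕ-inject₁ i) ⟨
      suc (toℕ (inject₁ i))  ∎

  lo≤r : toℕ (lo r) ℕ.≤ toℕ r
  lo≤r = ℕₚ.≤-pred (ℕₚ.<-≤-trans (lo<hi r) (hi≤1+r r))

module _ {c ℓ₁ ℓ₂} (P : Preorder c ℓ₁ ℓ₂) where
  open Preorder P renaming (Carrier to A; refl to ≲-refl; trans to ≲-trans)

  plateau-maximum : ∀ {n} (h : Fin (suc n) → A) (p : Fin n) →
    (∀ q → q Fin.< p → h (inject₁ q) ≲ h (fsuc q)) →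
    h (fsuc p) ≲ h (inject₁ p) →
    (∀ q → p Fin.< q → h (fsuc q) ≲ h (inject₁ q)) →
    ∀ s → h s ≲ h (inject₁ p)
  plateau-maximum {n} h p rising flat falling s = [ left s , right s ]′ (ℕₚ.≤-<-connex (toℕ s) (toℕ p))
    where
    left : ∀ s → toℕ s ℕ.≤ toℕ p → h s ≲ h (inject₁ p)
    left = >-weakInduction _
      (λ n≤p → contradiction (subst (ℕ._≤ toℕ p) (Finₚ.toℕ-fromℕ n) n≤p) (ℕₚ.<⇒≱ (Finₚ.toℕ<n p)))
      λ i ih i≤p → step i (subst (ℕ._≤ toℕ p) (Finₚ.toℕ-inject₁ i) i≤p) ih
      where
      step : ∀ i → toℕ i ℕ.≤ toℕ p → (toℕ (fsuc i) ℕ.≤ toℕ p → h (fsuc i) ≲ h (inject₁ p)) →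
             h (inject₁ i) ≲ h (inject₁ p)
      step i i≤p ih with Finₚ.<-cmp i p
      ... | tri< i<p _ _ = ≲-trans (rising i i<p) (ih i<p)
      ... | tri≈ _ refl _ = ≲-refl
      ... | tri> _ _ p<i = contradiction i≤p (ℕₚ.<⇒≱ p<i)
    right : ∀ s → toℕ p ℕ.< toℕ s → h s ≲ h (inject₁ p)
    right = <-weakInduction _ (λ ()) λ i ih p<1+i → step i (ℕₚ.≤-pred p<1+i) ih
      where
      step : ∀ i → toℕ p ℕ.≤ toℕ i → (toℕ p ℕ.< toℕ (inject₁ i) → h (inject₁ i) ≲ h (inject₁ p)) →
             h (fsuc i) ≲ h (inject₁ p)
      step i p≤i ih with Finₚ.<-cmp p i
      ... | tri< p<i _ _ = ≲-trans (falling i p<i) (ih (subst (toℕ p ℕ.<_) (sym (Finₚ.toℕ-inject₁ i)) p<i))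
      ... | tri≈ _ refl _ = flat
      ... | tri> _ _ i<p = contradiction p≤i (ℕₚ.<⇒≱ i<p)


module SupermodularSystem (R : Reals) {k : ℕ} (a : Fin k → Fin (suc k) → Reals.ℝ R)
  (a-supermodular : OrderedReals.StrictlySupermodular R a)
  (σ : Fin k → Fin (suc k) → Tropical.Sign R) where
  open Tropical R
  open OrderedReals R
  open MaxPlus R

  term : (Fin (suc k) → Rmax) → Fin k → Fin (suc k) → Rmax
  term z r s = just (a r s) ⊗ z s

  Tied : (Fin (suc k) → Rmax) → Fin k → Set
  Tied z r = term z r (inject₁ r) ≡ term z r (fsuc r)

  SignChange : Fin k → Set
  SignChange r = σ r (inject₁ r) ≢ σ r (fsuc r)

  AllBalanced : (Fin (suc k) → Rmax) → Set
  AllBalanced z = ∀ r → Balanced (σ r) (term z r)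

  maximizers-ordered : ∀ {z r₁ r₂ s₁ s₂ M₁ M₂} → r₁ Fin.< r₂ →
    term z r₁ s₂ ≡ just M₁ → UpperBound (term z r₁) M₁ →
    term z r₂ s₁ ≡ just M₂ → UpperBound (term z r₂) M₂ → s₂ Fin.≤ s₁
  maximizers-ordered {z} {r₁} {r₂} {s₁} {s₂} {M₁} {M₂} r₁<r₂ r₁s₂≡M₁ bound₁ r₂s₁≡M₂ bound₂ =
    ℕₚ.≮⇒≥ s₁≮s₂
    where
    open ≤-Reasoning
    bound-at : ∀ {r M s x} → UpperBound (term z r) M → z s ≡ just x → a r s + x ≤ M
    bound-at {r} {M} {s} bound zs≡x =
      [≤]-injective (subst (λ y → just (a r s) ⊗ y ≤₋ just M) zs≡x (bound s))
    s₁≮s₂ : ¬ (s₁ Fin.< s₂)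
    s₁≮s₂ s₁<s₂ with just-⊗-≡-just r₁s₂≡M₁ | just-⊗-≡-just r₂s₁≡M₂
    ... | x₂ , zs₂≡x₂ , a+x₂≡M₁ | x₁ , zs₁≡x₁ , a+x₁≡M₂ = begin-contradiction
      M₁ + M₂                          ≡⟨ cong₂ _+_ a+x₂≡M₁ a+x₁≡M₂ ⟨
      (a r₁ s₂ + x₂) + (a r₂ s₁ + x₁)  <⟨ supermodular-columnShift a-supermodular r₁<r₂ s₁<s₂ x₁ x₂ ⟩
      (a r₁ s₁ + x₁) + (a r₂ s₂ + x₂)  ≤⟨ +-mono-≤ (bound-at bound₁ zs₁≡x₁) (bound-at bound₂ zs₂≡x₂) ⟩
      M₁ + M₂                          ∎

  balanced⇒signChange×tied : ∀ {z} → NonZero z → AllBalanced z → ∀ r → SignChange r × Tied z r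
  balanced⇒signChange×tied {z} (s₀ , zs₀≢0) balanced r =
    subst₂ (λ l h → σ r l ≢ σ r h) (proj₁ position) (proj₂ position) (Max.signs-differ r) ,
    subst₂ (λ l h → term z r l ≡ term z r h) (proj₁ position) (proj₂ position)
      (trans (Max.attained-lo r) (sym (Max.attained-hi r)))
    where
    maximum : ∀ r → OppositeSignMaximum (σ r) (term z r)
    maximum r = balanced⇒oppositeSignMaximum (s₀ , zs₀≢0 ∘ just-⊗-≡-nothing) (balanced r)
    module Max r = OppositeSignMaximum (maximum r)
    position : Max.lo r ≡ inject₁ r × Max.hi r ≡ fsuc r
    position = interlacing Max.lo Max.hi Max.lo<hi
      (λ {r} {r′} r<r′ → maximizers-ordered r<r′ (Max.attained-hi r) (Max.upper-bound r)
                                                  (Max.attained-lo r′) (Max.upper-bound r′)) r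

  tied⇒balanced : ∀ {z} → NonZero z → (∀ r → SignChange r) → (∀ r → Tied z r) → AllBalanced z
  tied⇒balanced {z} (s₀ , zs₀≢0) signChange tied r = oppositeSignMaximum⇒balanced {σ = σ r} (record
    { value        = H r (inject₁ r)
    ; lo           = inject₁ r
    ; hi           = fsuc r
    ; lo<hi        = inject₁<fsuc r
    ; signs-differ = signChange r
    ; attained-lo  = term≡H r (inject₁ r)
    ; attained-hi  = trans (term≡H r (fsuc r)) (cong just (sym (H-tied r)))
    ; upper-bound  = λ s → subst (_≤₋ just (H r (inject₁ r))) (sym (term≡H r s)) [ H-maximum r s ]
    })
    where
    open ≤-Reasoning
    finite : ∀ s → ∃ λ x → z s ≡ just x
    finite = neighbour-induction _ (λ i → just-⊗-just (tied i)) (λ i → just-⊗-just (sym (tied i)))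
               (≢nothing⇒just zs₀≢0)
    w : Fin (suc k) → ℝ
    w s = proj₁ (finite s)
    H : Fin k → Fin (suc k) → ℝ
    H r s = a r s + w s
    term≡H : ∀ r s → term z r s ≡ just (H r s)
    term≡H r s = cong (just (a r s) ⊗_) (proj₂ (finite s))
    H-tied : ∀ r → H r (inject₁ r) ≡ H r (fsuc r)
    H-tied r = just-injective (trans (sym (term≡H r (inject₁ r))) (trans (tied r) (term≡H r (fsuc r))))
    H-rises : ∀ {q r} → q Fin.< r → H r (inject₁ q) < H r (fsuc q)
    H-rises {q} {r} q<r = +-cancelˡ-< (H q (inject₁ q)) (begin-strict
      H q (inject₁ q) + H r (inject₁ q)  ≡⟨ cong (_+ H r (inject₁ q)) (H-tied q) ⟩
      H q (fsuc q) + H r (inject₁ q)     <⟨ supermodular-columnShift a-supermodular q<r (inject₁<fsuc q) _ _ ⟩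
      H q (inject₁ q) + H r (fsuc q)     ∎)
    H-falls : ∀ {r q} → r Fin.< q → H r (fsuc q) < H r (inject₁ q)
    H-falls {r} {q} r<q = +-cancelʳ-< (H q (inject₁ q)) (begin-strict
      H r (fsuc q) + H q (inject₁ q)     <⟨ supermodular-columnShift a-supermodular r<q (inject₁<fsuc q) _ _ ⟩
      H r (inject₁ q) + H q (fsuc q)     ≡⟨ cong (H r (inject₁ q) +_) (H-tied q) ⟨
      H r (inject₁ q) + H q (inject₁ q)  ∎)
    H-maximum : ∀ r s → H r s ≤ H r (inject₁ r)
    H-maximum r = plateau-maximum ≤-preorder (H r) r
      (λ q q<r → inj₁ (H-rises q<r)) (inj₂ (sym (H-tied r))) (λ q r<q → inj₁ (H-falls r<q))

module SignedVandermonde (R : Reals) {p d k : ℕ} (t : Fin p → Reals.ℝ R)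
  (ε : Fin p → Fin d → Tropical.Sign R) (t↑ : Tropical.StrictlyIncreasingℝ R t)
  (I : Fin k → Fin p) (J : Fin (suc k) → Fin d)
  (I↑ : Tropical.StrictlyIncreasingFin R I) (J↑ : Tropical.StrictlyIncreasingFin R J) where
  open Tropical R
  open OrderedReals R
  open MaxPlus R

  modulus : Fin k → Fin (suc k) → ℝ
  modulus r s = toℕ (J s) · t (I r)

  modulus-supermodular : StrictlySupermodular modulus
  modulus-supermodular r₁<r₂ s₁<s₂ = ·-supermodular (J↑ _ _ s₁<s₂) (t↑ _ _ (I↑ _ _ r₁<r₂))

  open SupermodularSystem R modulus modulus-supermodular (λ r s → ε (I r) (J s)) public

  ratio : Fin k → ℝ
  ratio r = (toℕ (J (fsuc r)) ∸ toℕ (J (inject₁ r))) · t (I r)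

  modulus-step : ∀ r → modulus r (fsuc r) ≡ modulus r (inject₁ r) + ratio r
  modulus-step r = trans
    (cong (_· t (I r)) (sym (ℕₚ.m+[n∸m]≡n (ℕₚ.<⇒≤ (J↑ _ _ (inject₁<fsuc r))))))
    (·-distribʳ-+ (toℕ (J (inject₁ r))) _ (t (I r)))

  tied⇔recurrence : ∀ z r → Tied z r ⇔ (z (inject₁ r) ≡ just (ratio r) ⊗ z (fsuc r))
  tied⇔recurrence z r = mk⇔
    (λ tied → just-⊗-cancel (trans tied term-fsuc))
    (λ recurrence → trans (cong (just (modulus r (inject₁ r)) ⊗_) recurrence) (sym term-fsuc))
    where
    term-fsuc : term z r (fsuc r) ≡ just (modulus r (inject₁ r)) ⊗ (just (ratio r) ⊗ z (fsuc r))
    term-fsuc = trans (cong (λ c → just c ⊗ z (fsuc r)) (modulus-step r)) (just-⊗-assoc _ _ (z (fsuc r)))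

  C⁺-⊗ : ∀ i j x → C⁺ t ε i j ⊗ x ≡ onSign ⊕𝟙 (ε i j) (just (toℕ j · t i) ⊗ x)
  C⁺-⊗ i j x with ε i j
  ... | ⊕𝟙 = refl
  ... | ⊖𝟙 = refl

  C⁻-⊗ : ∀ i j x → C⁻ t ε i j ⊗ x ≡ onSign ⊖𝟙 (ε i j) (just (toℕ j · t i) ⊗ x)
  C⁻-⊗ i j x with ε i j
  ... | ⊕𝟙 = refl
  ... | ⊖𝟙 = refl

  Solves : (Fin (suc k) → Rmax) → Set
  Solves z = ∀ r → (sub (C⁺ t ε) I J ⊠ z) r ≡ (sub (C⁻ t ε) I J ⊠ z) r

  OppositeSigns : Fin k → Set
  OppositeSigns r = ⟦ ε (I r) (J (inject₁ r)) ⟧ ⊙ ⟦ ε (I r) (J (fsuc r)) ⟧ ≡ ⟦ ⊖𝟙 ⟧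

  Relation : (Fin (suc k) → Rmax) → Fin k → Set
  Relation z r = ι (z (inject₁ r)) ≡
    ⊖ (pos (ratio r) ⊙ ⟦ ε (I r) (J (inject₁ r)) ⟧ ⊙ ⟦ ε (I r) (J (fsuc r)) ⟧ ⊙ ι (z (fsuc r)))

  solves⇔allBalanced : ∀ z → Solves z ⇔ AllBalanced z
  solves⇔allBalanced z = mk⇔
    (λ solves r → trans (sym (C⁺z≡ r)) (trans (solves r) (C⁻z≡ r)))
    (λ balanced r → trans (C⁺z≡ r) (trans (balanced r) (sym (C⁻z≡ r))))
    where
    C⁺z≡ : ∀ r → (sub (C⁺ t ε) I J ⊠ z) r ≡ ⨁ (λ s → onSign ⊕𝟙 (ε (I r) (J s)) (term z r s))
    C⁺z≡ r = ⨁-cong (λ s → C⁺-⊗ (I r) (J s) (z s))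
    C⁻z≡ : ∀ r → (sub (C⁻ t ε) I J ⊠ z) r ≡ ⨁ (λ s → onSign ⊖𝟙 (ε (I r) (J s)) (term z r s))
    C⁻z≡ r = ⨁-cong (λ s → C⁻-⊗ (I r) (J s) (z s))

  signChange⇔oppositeSigns : ∀ r → SignChange r ⇔ OppositeSigns r
  signChange⇔oppositeSigns r =
    ⇔-sym (signProduct≡⊖𝟙⇔≢ {ε (I r) (J (inject₁ r))} {ε (I r) (J (fsuc r))})

  solution⇒oppositeSigns×tied : ∀ {z} → NonZero z → Solves z → ∀ r → OppositeSigns r × Tied z r
  solution⇒oppositeSigns×tied {z} z≢0 solves r =
    Equivalence.to (signChange⇔oppositeSigns r) (proj₁ signChange×tied) , proj₂ signChange×tied
    where
    signChange×tied : SignChange r × Tied z r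
    signChange×tied = balanced⇒signChange×tied z≢0 (Equivalence.to (solves⇔allBalanced z) solves) r

  tied⇒solution : ∀ {z} → NonZero z → (∀ r → OppositeSigns r) → (∀ r → Tied z r) → Solves z
  tied⇒solution {z} z≢0 opposite tied = Equivalence.from (solves⇔allBalanced z)
    (tied⇒balanced z≢0 (λ r → Equivalence.from (signChange⇔oppositeSigns r) (opposite r)) tied)

  relation⇔tied : ∀ z r → OppositeSigns r → Relation z r ⇔ Tied z r
  relation⇔tied z r opposite = ⇔-trans (signedRelation⇔ opposite) (⇔-sym (tied⇔recurrence z r))

  ∃nonZeroTied : ∃ λ z → NonZero z × ∀ r → Tied z r
  ∃nonZeroTied = z , (Fin.zero , λ ()) , λ r → Equivalence.from (tied⇔recurrence z r)
                                             (cong just (iterateBackward-inject₁ _ 0# r))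
    where
    z : Fin (suc k) → Rmax
    z s = just (iterateBackward (λ r w → ratio r + w) 0# s)

corollary6 : (R : Reals) → let open Tropical R in
    (p d k : ℕ) (t : Fin p → ℝ) (ε : Fin p → Fin d → Sign) →
    StrictlyIncreasingℝ t →
    (I : Fin k → Fin p) (J : Fin (suc k) → Fin d) →
    StrictlyIncreasingFin I → StrictlyIncreasingFin J → suc k ≤ℕ d →
    let Cp = sub (C⁺ t ε) I J
        Cm = sub (C⁻ t ε) I J
        Solves = λ (z : Fin (suc k) → Rmax) → ∀ r → (Cp ⊠ z) r ≡ (Cm ⊠ z) r
        Cond = ∀ (r : Fin k) → ⟦ ε (I r) (J (inject₁ r)) ⟧ ⊙ ⟦ ε (I r) (J (fsuc r)) ⟧ ≡ ⟦ ⊖𝟙 ⟧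
        Rel = λ (z : Fin (suc k) → Rmax) → ∀ (r : Fin k) →
          ι (z (inject₁ r)) ≡
            ⊖ (pos ((toℕ (J (fsuc r)) ∸ toℕ (J (inject₁ r))) · t (I r))
                 ⊙ ⟦ ε (I r) (J (inject₁ r)) ⟧ ⊙ ⟦ ε (I r) (J (fsuc r)) ⟧
                 ⊙ ι (z (fsuc r)))
    in ((∃ λ z → NonZero z × Solves z) ⇔ Cond)
       × (Cond → ∀ z → NonZero z → (Solves z ⇔ Rel z))
-- The hypothesis suc k ≤ d is implied by J being strictly increasing, hence unused.
corollary6 R p d k t ε t↑ I J I↑ J↑ _ =
  mk⇔ (λ (z , z≢0 , solves) r → proj₁ (solution⇒oppositeSigns×tied z≢0 solves r))
      (λ opposite → let z , z≢0 , tied = ∃nonZeroTied in z , z≢0 , tied⇒solution z≢0 opposite tied) ,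
  λ opposite z z≢0 → mk⇔
    (λ solves r → Equivalence.from (relation⇔tied z r (opposite r)) (proj₂ (solution⇒oppositeSigns×tied z≢0 solves r)))
    (λ relation → tied⇒solution z≢0 opposite λ r → Equivalence.to (relation⇔tied z r (opposite r)) (relation r))
  where open SignedVandermonde R t ε t↑ I J I↑ J↑
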